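{- Let $\alpha\in\{231,312\}$ and let $i_n^k(\alpha)$ denote the number of involutions of $\{1,\dots,n\}$ with exactly $k$ fixed points that avoid the pattern $\alpha$. For $n\geq 1$ and $0\leq k\leq n$, $$i_n^k(\alpha)=\begin{cases}2^{\frac{n-k-2}{2}}\left(\binom{\frac{n+k}{2}}{\frac{n-k}{2}}+\binom{\frac{n+k-2}{2}}{\frac{n-k}{2}}\right) & \text{if } n+k \text{ is even},\\ 0 & \text{if } n+k \text{ is odd}.\end{cases}$$
   Context: Permutations are in one-line notation. An involution is a permutation with $\pi^{ -1}=\pi$; a fixed point is an $i$ with $\pi_i=i$. For $\alpha\in S_m$, $\pi$ contains $\alpha$ if some subsequence $\pi_{i_1}\cdots\pi_{i_m}$ ($i_1<\dots<i_m$) is order-isomorphic to $\alpha$; otherwise $\pi$ avoids $\alpha$. Binomial coefficients $\binom{a}{b}$ with integer $a$ and $b$ are taken as $1$ if $b=0$ and $0$ if $b<0$ or $b>a\geq 0$ (in particular $\binom{a}{b}=0$ when $0\le a<b$). -}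

module Defs where

open import Data.Bool using (Bool; true; false; _∧_; not; if_then_else_)
open import Data.Nat using (ℕ; zero; suc; _≡ᵇ_; _<ᵇ_; _+_)
open import Data.List using (List; []; _∷_; map; concatMap; length; filterᵇ; applyUpTo; zipWith)
open import Data.Bool.ListAction using (all; any)

range1 : ℕ → List ℕ
range1 n = applyUpTo suc n

words : ℕ → List ℕ → List (List ℕ)
words zero    xs = [] ∷ []
words (suc m) xs = concatMap (λ x → map (x ∷_) (words m xs)) xs

-- 1-based entry π_i of a word (0 if out of range)
at : List ℕ → ℕ → ℕ
at []       _             = 0
at (x ∷ xs) zero          = 0
at (x ∷ xs) (suc zero)    = x
at (x ∷ xs) (suc (suc i)) = at xs (suc i)

-- π (a word of length n) is a permutation of {1,…,n} in one-line notation: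
-- every value 1..n occurs
isPerm : ℕ → List ℕ → Bool
isPerm n π = all (λ v → any (λ x → x ≡ᵇ v) π) (range1 n)

perms : ℕ → List (List ℕ)
perms n = filterᵇ (isPerm n) (words n (range1 n))

isInvolution : ℕ → List ℕ → Bool
isInvolution n π = all (λ i → at π (at π i) ≡ᵇ i) (range1 n)

fixedPoints : ℕ → List ℕ → ℕ
fixedPoints n π = length (filterᵇ (λ i → at π i ≡ᵇ i) (range1 n))

subseqs : ℕ → List ℕ → List (List ℕ)
subseqs zero    _        = [] ∷ []
subseqs (suc m) []       = []
subseqs (suc m) (x ∷ xs) = map (x ∷_) (subseqs m xs) ++' subseqs (suc m) xs
  where
  _++'_ : List (List ℕ) → List (List ℕ) → List (List ℕ)
  []       ++' ys = ys
  (z ∷ zs) ++' ys = z ∷ (zs ++' ys)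

_==_ : Bool → Bool → Bool
true  == b = b
false == b = not b

orderIso : List ℕ → List ℕ → Bool
orderIso []       []       = true
orderIso (x ∷ xs) (a ∷ as) =
  all (λ b → b) (zipWith (λ y b → (x <ᵇ y) == (a <ᵇ b)) xs as) ∧ orderIso xs as
orderIso _        _        = false

contains : List ℕ → List ℕ → Bool
contains α π = any (λ s → orderIso s α) (subseqs (length α) π)

invCount : List ℕ → ℕ → ℕ → ℕ
invCount α n k =
  length (filterᵇ (λ π → isInvolution n π ∧ (fixedPoints n π ≡ᵇ k) ∧ not (contains α π)) (perms n))

{-# OPTIONS --safe #-}
module Submission where

-- A 312-avoiding involution is the inverse of a 231-avoiding one, so for involutions both
-- patterns define the same class. If π is a 231-avoiding involution with π(1) = s, then
-- π(s) = 1 and every earlier entry exceeds its successor (else it forms a 231 with that 1), so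
-- π starts with the block s, s−1, …, 1 and continues with a 231-avoiding involution shifted up
-- by s. Hence these involutions are exactly the direct sums of decreasing blocks, in bijection
-- with compositions of n, and a block has a fixed point iff its size is odd: i_n^k(α) counts
-- the compositions of n with k odd parts. These exist only for n = k + 2m, and splitting off
-- the first part (1, 2, or a part of size at least 3 shrunk by 2) shows that their number
-- f(m, k) satisfies f(m+1, k+1) = f(m+1, k) + 2 f(m, k+1), which Pascal's rule solves.

open import Defs
open import Data.Bool using (Bool; true; false; T; not; _∧_; if_then_else_)
open import Data.Bool.ListAction using (any)
open import Data.Bool.Properties using (T-∧)
open import Data.Empty using (⊥-elim)
open import Data.List
  using (List; []; _∷_; [_]; _++_; map; length; drop; filterᵇ; applyUpTo; applyDownFrom; cartesianProductWith; concatMap)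
open import Data.List.Properties
  using (∷-injective; ∷-injectiveʳ; length-map; length-++; length-applyDownFrom; length-drop; ++-cancelˡ; map-injective;
         map-applyUpTo)
open import Data.List.Membership.Propositional using (_∈_; find; lose)
open import Data.List.Membership.Propositional.Properties
  using (∈-applyUpTo⁺; ∈-applyUpTo⁻; ∈-cartesianProductWith⁺; ∈-cartesianProductWith⁻; ∈-++⁻; ∈-++⁺ˡ; ∈-++⁺ʳ;
         ∈-map⁺; ∈-map⁻; ∈-filter⁺; ∈-filter⁻)
open import Data.List.Membership.Propositional.Properties.WithK using (unique∧set⇒bag)
open import Data.List.Relation.Binary.BagAndSetEquality using (∼bag⇒↭)
open import Data.List.Relation.Binary.Disjoint.Propositional using (Disjoint)
open import Data.List.Relation.Binary.Permutation.Propositional.Properties using (↭-length)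
open import Data.List.Relation.Unary.All using (All; []; _∷_; tabulate)
import Data.List.Relation.Unary.All as All
import Data.List.Relation.Unary.All.Properties as All
open import Data.List.Relation.Unary.AllPairs using ([]; _∷_)
open import Data.List.Relation.Unary.Any using (Any; here; there)
import Data.List.Relation.Unary.Any as Any
open import Data.List.Relation.Unary.Any.Properties using (any⁺; any⁻)
open import Data.List.Relation.Unary.Unique.Propositional using (Unique)
import Data.List.Relation.Unary.Unique.Propositional.Properties as Unique
open import Data.Nat
  using (ℕ; zero; suc; _+_; _*_; _∸_; _^_; _/_; _≤_; _<_; z≤n; s≤s; z<s; s<s; s<s⁻¹; s≤s⁻¹; _<ᵇ_; _≡ᵇ_)
open import Data.Nat.Combinatorics using (_C_; nCn≡1; k>n⇒nCk≡0; nCk+nC[k+1]≡[n+1]C[k+1])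
open import Data.Nat.DivMod using (m*n/n≡m)
open import Data.Nat.Divisibility using (_∣_; divides; ∣m+n∣m⇒∣n)
open import Data.Nat.Induction using (<-wellFounded)
open import Data.Nat.ListAction using (sum)
open import Data.Nat.Properties
open import Data.Nat.Solver using (module +-*-Solver)
open import Data.Product using (_×_; _,_; proj₁; ∃-syntax)
open import Data.Sum using (_⊎_; inj₁; inj₂; [_,_]′)
open import Function.Base using (_∘_)
open import Function.Bundles using (_⇔_; mk⇔; Equivalence)
import Function.Properties.Equivalence as ⇔
open import Induction.WellFounded using (Acc; acc)
open import Relation.Binary.Definitions using (tri<; tri≈; tri>)
open import Relation.Binary.PropositionalEquality hiding ([_])
open import Relation.Nullary using (¬_; contradiction)
open import Relation.Nullary.Decidable using (T?)
open import Relation.Nullary.Reflects using (ofʸ; ofⁿ)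

private variable
  A B : Set

unique∧same-members⇒length≡ : {xs ys : List A} → Unique xs → Unique ys →
  (∀ {z} → z ∈ xs ⇔ z ∈ ys) → length xs ≡ length ys
unique∧same-members⇒length≡ u v same = ↭-length (∼bag⇒↭ (unique∧set⇒bag u v same))

words-suc : ∀ m (xs : List ℕ) → words (suc m) xs ≡ cartesianProductWith _∷_ xs (words m xs)
words-suc m xs = prepend-each xs
  where
  prepend-each : ∀ ys → concatMap (λ y → map (y ∷_) (words m xs)) ys ≡ cartesianProductWith _∷_ ys (words m xs)
  prepend-each []       = refl
  prepend-each (y ∷ ys) = cong (map (y ∷_) (words m xs) ++_) (prepend-each ys)

∈-words⁺ : ∀ {xs w} → All (_∈ xs) w → w ∈ words (length w) xs
∈-words⁺ []                        = here refl
∈-words⁺ {xs} {x ∷ w} (x∈xs ∷ w⊆xs) rewrite words-suc (length w) xs =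
  ∈-cartesianProductWith⁺ _∷_ x∈xs (∈-words⁺ w⊆xs)

length-∈-words : ∀ m (xs : List ℕ) {w} → w ∈ words m xs → length w ≡ m
length-∈-words zero    xs (here refl) = refl
length-∈-words (suc m) xs w∈ rewrite words-suc m xs
  with _ , w′ , _ , w′∈ , refl ← ∈-cartesianProductWith⁻ _∷_ xs (words m xs) w∈ =
  cong suc (length-∈-words m xs w′∈)

words-unique : ∀ m {xs : List ℕ} → Unique xs → Unique (words m xs)
words-unique zero    _  = [] ∷ []
words-unique (suc m) {xs} u rewrite words-suc m xs =
  Unique.cartesianProductWith⁺ _∷_ ∷-injective u (words-unique m u)

∈-range1⁺ : ∀ {n i} → i < n → suc i ∈ range1 n
∈-range1⁺ = ∈-applyUpTo⁺ suc

∈-range1⁻ : ∀ {n v} → v ∈ range1 n → ∃[ i ] v ≡ suc i × i < n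
∈-range1⁻ v∈ with i , i<n , refl ← ∈-applyUpTo⁻ suc v∈ = i , refl , i<n

range1-unique : ∀ n → Unique (range1 n)
range1-unique n = Unique.applyUpTo⁺₁ suc n (λ i<j _ → <⇒≢ i<j ∘ suc-injective)

-- 0-based entries: `π ⟨ i ⟩` is the (i+1)-st entry of π, and 0 beyond its end.
infix 10 _⟨_⟩
_⟨_⟩ : List ℕ → ℕ → ℕ
π ⟨ i ⟩ = at π (suc i)

⟨⟩-++ˡ : ∀ xs ys {i} → i < length xs → (xs ++ ys) ⟨ i ⟩ ≡ xs ⟨ i ⟩
⟨⟩-++ˡ (x ∷ xs) ys {zero}  _         = refl
⟨⟩-++ˡ (x ∷ xs) ys {suc i} (s<s i<n) = ⟨⟩-++ˡ xs ys i<n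

⟨⟩-++ʳ : ∀ xs ys j → (xs ++ ys) ⟨ length xs + j ⟩ ≡ ys ⟨ j ⟩
⟨⟩-++ʳ []       ys j = refl
⟨⟩-++ʳ (x ∷ xs) ys j = ⟨⟩-++ʳ xs ys j

⟨⟩-map : ∀ (f : ℕ → ℕ) xs {i} → i < length xs → map f xs ⟨ i ⟩ ≡ f (xs ⟨ i ⟩)
⟨⟩-map f (x ∷ xs) {zero}  _         = refl
⟨⟩-map f (x ∷ xs) {suc i} (s<s i<n) = ⟨⟩-map f xs i<n

⟨⟩-drop : ∀ s xs j → drop s xs ⟨ j ⟩ ≡ xs ⟨ s + j ⟩
⟨⟩-drop zero    xs       j = refl
⟨⟩-drop (suc s) []       j = refl
⟨⟩-drop (suc s) (x ∷ xs) j = ⟨⟩-drop s xs j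

⟨⟩-∈ : ∀ xs {i} → i < length xs → xs ⟨ i ⟩ ∈ xs
⟨⟩-∈ (x ∷ xs) {zero}  _         = here refl
⟨⟩-∈ (x ∷ xs) {suc i} (s<s i<n) = there (⟨⟩-∈ xs i<n)

⟨⟩-All : ∀ {P : ℕ → Set} xs → (∀ {i} → i < length xs → P (xs ⟨ i ⟩)) → All P xs
⟨⟩-All []       _ = []
⟨⟩-All (x ∷ xs) p = p z<s ∷ ⟨⟩-All xs (p ∘ s<s)

⟨⟩-ext : ∀ {xs ys} → length xs ≡ length ys → (∀ {i} → i < length xs → xs ⟨ i ⟩ ≡ ys ⟨ i ⟩) →
  xs ≡ ys
⟨⟩-ext {[]}     {[]}     _   _  = refl
⟨⟩-ext {x ∷ xs} {y ∷ ys} len eq = cong₂ _∷_ (eq z<s) (⟨⟩-ext (suc-injective len) (eq ∘ s<s))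

at≢0⇒index : ∀ xs j → at xs j ≢ 0 → ∃[ v ] j ≡ suc v × v < length xs
at≢0⇒index []       j             at≢0 = ⊥-elim (at≢0 refl)
at≢0⇒index (x ∷ xs) zero          at≢0 = ⊥-elim (at≢0 refl)
at≢0⇒index (x ∷ xs) (suc zero)    _    = zero , refl , z<s
at≢0⇒index (x ∷ xs) (suc (suc j)) at≢0 with v , refl , v<n ← at≢0⇒index xs (suc j) at≢0 =
  suc v , refl , s<s v<n

-- No range condition is needed: `at` is 0 off the word, so `involutive` already forces every
-- entry into 1 … n (see `entry`).
record Involution (n : ℕ) (π : List ℕ) : Set where
  field
    length≡    : length π ≡ n
    involutive : ∀ {i} → i < n → at π (π ⟨ i ⟩) ≡ suc i

  entry : ∀ {i} → i < n → ∃[ v ] π ⟨ i ⟩ ≡ suc v × v < n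
  entry i<n with v , eq , v<∣π∣ ← at≢0⇒index π _ (λ at≡0 → 0≢1+n (trans (sym at≡0) (involutive i<n))) =
    v , eq , subst (v <_) length≡ v<∣π∣

  inverse : ∀ {i v} → i < n → π ⟨ i ⟩ ≡ suc v → π ⟨ v ⟩ ≡ suc i
  inverse i<n eq = trans (cong (at π) (sym eq)) (involutive i<n)

  injective : ∀ {i j} → i < n → j < n → π ⟨ i ⟩ ≡ π ⟨ j ⟩ → i ≡ j
  injective i<n j<n eq = suc-injective (trans (sym (involutive i<n)) (trans (cong (at π) eq) (involutive j<n)))

-- Occurrences of 231 and 312

map-++-unique : ∀ (g : A → B) (f : List A → List B → List B) →
  (∀ ys → f [] ys ≡ ys) → (∀ z zs ys → f (z ∷ zs) ys ≡ g z ∷ f zs ys) →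
  ∀ xs ys → f xs ys ≡ map g xs ++ ys
map-++-unique g f f[] f∷ []       ys = f[] ys
map-++-unique g f f[] f∷ (z ∷ zs) ys = trans (f∷ z zs ys) (cong (g z ∷_) (map-++-unique g f f[] f∷ zs ys))

-- `subseqs` appends with a where-bound copy of `_++_`, which cannot be named;
-- abstracting its arguments lets unification recover it inside `prepend-append`.
subseqs-suc : ∀ m x xs → subseqs (suc m) (x ∷ xs) ≡ map (x ∷_) (subseqs m xs) ++ subseqs (suc m) xs
subseqs-suc m x xs =
  trans unfolded
        (map-++-unique (x ∷_) prepend-append (λ _ → refl) (λ _ _ _ → refl) (subseqs m xs) (subseqs (suc m) xs))
  where
  prepend-append : List (List ℕ) → List (List ℕ) → List (List ℕ)
  prepend-append = _
  unfolded : subseqs (suc m) (x ∷ xs) ≡ prepend-append (subseqs m xs) (subseqs (suc m) xs)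
  unfolded with subseqs m xs | subseqs (suc m) xs
  ... | _ | _ = refl

∈-subseqs-suc⁻ : ∀ m x xs {s} → s ∈ subseqs (suc m) (x ∷ xs) →
  (∃[ t ] s ≡ x ∷ t × t ∈ subseqs m xs) ⊎ s ∈ subseqs (suc m) xs
∈-subseqs-suc⁻ m x xs s∈ rewrite subseqs-suc m x xs with ∈-++⁻ (map (x ∷_) (subseqs m xs)) s∈
... | inj₁ s∈ˡ with t , t∈ , refl ← ∈-map⁻ (x ∷_) s∈ˡ = inj₁ (t , refl , t∈)
... | inj₂ s∈ʳ = inj₂ s∈ʳ

∈-subseqs-suc⁺ˡ : ∀ m x xs {t} → t ∈ subseqs m xs → x ∷ t ∈ subseqs (suc m) (x ∷ xs)
∈-subseqs-suc⁺ˡ m x xs t∈ rewrite subseqs-suc m x xs = ∈-++⁺ˡ (∈-map⁺ (x ∷_) t∈)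

∈-subseqs-suc⁺ʳ : ∀ m x xs {s} → s ∈ subseqs (suc m) xs → s ∈ subseqs (suc m) (x ∷ xs)
∈-subseqs-suc⁺ʳ m x xs s∈ rewrite subseqs-suc m x xs = ∈-++⁺ʳ (map (x ∷_) (subseqs m xs)) s∈

∈-subseqs₁⁻ : ∀ π {s} → s ∈ subseqs 1 π → ∃[ l ] l < length π × s ≡ π ⟨ l ⟩ ∷ []
∈-subseqs₁⁻ (x ∷ xs) s∈ with ∈-subseqs-suc⁻ 0 x xs s∈
... | inj₁ (_ , refl , here refl) = 0 , z<s , refl
... | inj₂ s∈′ with l , l< , refl ← ∈-subseqs₁⁻ xs s∈′ = suc l , s<s l< , refl

∈-subseqs₂⁻ : ∀ π {s} → s ∈ subseqs 2 π →
  ∃[ j ] ∃[ l ] j < l × l < length π × s ≡ π ⟨ j ⟩ ∷ π ⟨ l ⟩ ∷ []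
∈-subseqs₂⁻ (x ∷ xs) s∈ with ∈-subseqs-suc⁻ 1 x xs s∈
... | inj₁ (_ , refl , t∈) with l , l< , refl ← ∈-subseqs₁⁻ xs t∈ = 0 , suc l , z<s , s<s l< , refl
... | inj₂ s∈′ with j , l , j<l , l< , refl ← ∈-subseqs₂⁻ xs s∈′ = suc j , suc l , s<s j<l , s<s l< , refl

∈-subseqs₃⁻ : ∀ π {s} → s ∈ subseqs 3 π →
  ∃[ i ] ∃[ j ] ∃[ l ] i < j × j < l × l < length π × s ≡ π ⟨ i ⟩ ∷ π ⟨ j ⟩ ∷ π ⟨ l ⟩ ∷ []
∈-subseqs₃⁻ (x ∷ xs) s∈ with ∈-subseqs-suc⁻ 2 x xs s∈
... | inj₁ (_ , refl , t∈) with j , l , j<l , l< , refl ← ∈-subseqs₂⁻ xs t∈ =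
  0 , suc j , suc l , z<s , s<s j<l , s<s l< , refl
... | inj₂ s∈′ with i , j , l , i<j , j<l , l< , refl ← ∈-subseqs₃⁻ xs s∈′ =
  suc i , suc j , suc l , s<s i<j , s<s j<l , s<s l< , refl

∈-subseqs₁⁺ : ∀ π {l} → l < length π → π ⟨ l ⟩ ∷ [] ∈ subseqs 1 π
∈-subseqs₁⁺ (x ∷ xs) {zero}  _        = ∈-subseqs-suc⁺ˡ 0 x xs (here refl)
∈-subseqs₁⁺ (x ∷ xs) {suc l} (s<s l<) = ∈-subseqs-suc⁺ʳ 0 x xs (∈-subseqs₁⁺ xs l<)

∈-subseqs₂⁺ : ∀ π {j l} → j < l → l < length π → π ⟨ j ⟩ ∷ π ⟨ l ⟩ ∷ [] ∈ subseqs 2 π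
∈-subseqs₂⁺ (x ∷ xs) {zero}  {suc l} _         (s<s l<) = ∈-subseqs-suc⁺ˡ 1 x xs (∈-subseqs₁⁺ xs l<)
∈-subseqs₂⁺ (x ∷ xs) {suc j} {suc l} (s<s j<l) (s<s l<) = ∈-subseqs-suc⁺ʳ 1 x xs (∈-subseqs₂⁺ xs j<l l<)

∈-subseqs₃⁺ : ∀ π {i j l} → i < j → j < l → l < length π →
  π ⟨ i ⟩ ∷ π ⟨ j ⟩ ∷ π ⟨ l ⟩ ∷ [] ∈ subseqs 3 π
∈-subseqs₃⁺ (x ∷ xs) {zero}  {suc j} {suc l} _         (s<s j<l) (s<s l<) =
  ∈-subseqs-suc⁺ˡ 2 x xs (∈-subseqs₂⁺ xs j<l l<)
∈-subseqs₃⁺ (x ∷ xs) {suc i} {suc j} {suc l} (s<s i<j) (s<s j<l) (s<s l<) =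
  ∈-subseqs-suc⁺ʳ 2 x xs (∈-subseqs₃⁺ xs i<j j<l l<)

Occurs : (ℕ → ℕ → ℕ → Set) → List ℕ → Set
Occurs shape π =
  ∃[ i ] ∃[ j ] ∃[ l ] i < j × j < l × l < length π × shape (π ⟨ i ⟩) (π ⟨ j ⟩) (π ⟨ l ⟩)

OrderIso₃ : List ℕ → ℕ → ℕ → ℕ → Set
OrderIso₃ α x y z = T (orderIso (x ∷ y ∷ z ∷ []) α)

contains₃⇔ : ∀ a b c π → T (contains (a ∷ b ∷ c ∷ []) π) ⇔ Occurs (OrderIso₃ (a ∷ b ∷ c ∷ [])) π
contains₃⇔ a b c π = mk⇔ to from
  where
  iso = λ s → orderIso s (a ∷ b ∷ c ∷ [])
  to : T (contains (a ∷ b ∷ c ∷ []) π) → Occurs (OrderIso₃ (a ∷ b ∷ c ∷ [])) π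
  to t with s , s∈ , iso-s ← find (any⁻ iso (subseqs 3 π) t)
       with i , j , l , i<j , j<l , l< , refl ← ∈-subseqs₃⁻ π s∈ = i , j , l , i<j , j<l , l< , iso-s
  from : Occurs (OrderIso₃ (a ∷ b ∷ c ∷ [])) π → T (contains (a ∷ b ∷ c ∷ []) π)
  from (i , j , l , i<j , j<l , l< , iso-s) = any⁺ iso (lose (∈-subseqs₃⁺ π i<j j<l l<) iso-s)

Shape231 Shape312 : ℕ → ℕ → ℕ → Set
Shape231 a b c = c < a × a < b
Shape312 a b c = b < c × c < a

Avoids231 : List ℕ → Set
Avoids231 π = ¬ Occurs Shape231 π

orderIso-231⁻ : ∀ {x y z} → OrderIso₃ (2 ∷ 3 ∷ 1 ∷ []) x y z → z ≤ x × x < y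
orderIso-231⁻ {x} {y} {z} t with x <ᵇ y | <ᵇ-reflects-< x y | x <ᵇ z | <ᵇ-reflects-< x z
... | true  | ofʸ x<y | false | ofⁿ x≮z = ≮⇒≥ x≮z , x<y
... | true  | _       | true  | _       = ⊥-elim t
... | false | _       | _     | _       = ⊥-elim t

orderIso-312⁻ : ∀ {x y z} → OrderIso₃ (3 ∷ 1 ∷ 2 ∷ []) x y z → y < z × z ≤ x
orderIso-312⁻ {x} {y} {z} t with x <ᵇ y | x <ᵇ z | <ᵇ-reflects-< x z | y <ᵇ z | <ᵇ-reflects-< y z
... | false | false | ofⁿ x≮z | true  | ofʸ y<z = y<z , ≮⇒≥ x≮z
... | false | false | _       | false | _       = ⊥-elim t
... | false | true  | _       | _     | _       = ⊥-elim t
... | true  | _     | _       | _     | _       = ⊥-elim t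

<⇒<ᵇ≡true : ∀ {x y} → x < y → (x <ᵇ y) ≡ true
<⇒<ᵇ≡true {x} {y} x<y with x <ᵇ y | <ᵇ-reflects-< x y
... | true  | _       = refl
... | false | ofⁿ x≮y = contradiction x<y x≮y

≥⇒<ᵇ≡false : ∀ {x y} → y ≤ x → (x <ᵇ y) ≡ false
≥⇒<ᵇ≡false {x} {y} y≤x with x <ᵇ y | <ᵇ-reflects-< x y
... | false | _       = refl
... | true  | ofʸ x<y = contradiction y≤x (<⇒≱ x<y)

orderIso-231⁺ : ∀ {x y z} → Shape231 x y z → OrderIso₃ (2 ∷ 3 ∷ 1 ∷ []) x y z
orderIso-231⁺ (z<x , x<y)
  rewrite <⇒<ᵇ≡true x<y | ≥⇒<ᵇ≡false (<⇒≤ z<x) | ≥⇒<ᵇ≡false (<⇒≤ (<-trans z<x x<y)) = _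

orderIso-312⁺ : ∀ {x y z} → Shape312 x y z → OrderIso₃ (3 ∷ 1 ∷ 2 ∷ []) x y z
orderIso-312⁺ (y<z , z<x)
  rewrite ≥⇒<ᵇ≡false (<⇒≤ (<-trans y<z z<x)) | ≥⇒<ᵇ≡false (<⇒≤ z<x) | <⇒<ᵇ≡true y<z = _

module _ {n π} (π-inv : Involution n π) where
  open Involution π-inv

  private
    <-from-≤ : ∀ {i l} → i < l → l < n → π ⟨ l ⟩ ≤ π ⟨ i ⟩ → π ⟨ l ⟩ < π ⟨ i ⟩
    <-from-≤ i<l l<n πl≤πi = ≤∧≢⇒< πl≤πi (λ eq → <⇒≢ i<l (sym (injective l<n (<-trans i<l l<n) eq)))

    <n : ∀ {l} → l < length π → l < n
    <n = subst (_ <_) length≡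

    <∣π∣ : ∀ {l} → l < n → l < length π
    <∣π∣ = subst (_ <_) (sym length≡)

    position-of : ∀ {i} → i < n → ∃[ a ] π ⟨ i ⟩ ≡ suc a × a < n × π ⟨ a ⟩ ≡ suc i
    position-of i<n with a , eq , a<n ← entry i<n = a , eq , a<n , inverse i<n eq

  contains231⇔ : T (contains (2 ∷ 3 ∷ 1 ∷ []) π) ⇔ Occurs Shape231 π
  contains231⇔ = mk⇔ to from
    where
    to : T (contains (2 ∷ 3 ∷ 1 ∷ []) π) → Occurs Shape231 π
    to t with i , j , l , i<j , j<l , l< , iso ← Equivalence.to (contains₃⇔ 2 3 1 π) t
         with πl≤πi , πi<πj ← orderIso-231⁻ iso =
      i , j , l , i<j , j<l , l< , <-from-≤ (<-trans i<j j<l) (<n l<) πl≤πi , πi<πj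
    from : Occurs Shape231 π → T (contains (2 ∷ 3 ∷ 1 ∷ []) π)
    from (i , j , l , i<j , j<l , l< , shape) =
      Equivalence.from (contains₃⇔ 2 3 1 π) (i , j , l , i<j , j<l , l< , orderIso-231⁺ shape)

  contains312⇔ : T (contains (3 ∷ 1 ∷ 2 ∷ []) π) ⇔ Occurs Shape312 π
  contains312⇔ = mk⇔ to from
    where
    to : T (contains (3 ∷ 1 ∷ 2 ∷ []) π) → Occurs Shape312 π
    to t with i , j , l , i<j , j<l , l< , iso ← Equivalence.to (contains₃⇔ 3 1 2 π) t
         with πj<πl , πl≤πi ← orderIso-312⁻ iso =
      i , j , l , i<j , j<l , l< , πj<πl , <-from-≤ (<-trans i<j j<l) (<n l<) πl≤πi
    from : Occurs Shape312 π → T (contains (3 ∷ 1 ∷ 2 ∷ []) π)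
    from (i , j , l , i<j , j<l , l< , shape) =
      Equivalence.from (contains₃⇔ 3 1 2 π) (i , j , l , i<j , j<l , l< , orderIso-312⁺ shape)

  -- 312 and 231 are inverse permutations.
  occurs312⇔occurs231 : Occurs Shape312 π ⇔ Occurs Shape231 π
  occurs312⇔occurs231 = mk⇔ to from
    where
    to : Occurs Shape312 π → Occurs Shape231 π
    to (i , j , l , i<j , j<l , l< , πj<πl , πl<πi)
      with a , πi≡ , a<n , πa≡ ← position-of (<-trans i<j (<-trans j<l (<n l<)))
         | b , πj≡ , _   , πb≡ ← position-of (<-trans j<l (<n l<))
         | c , πl≡ , _   , πc≡ ← position-of (<n l<) =
      b , c , a , s<s⁻¹ (subst₂ _<_ πj≡ πl≡ πj<πl) , s<s⁻¹ (subst₂ _<_ πl≡ πi≡ πl<πi) , <∣π∣ a<n ,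
      subst₂ _<_ (sym πa≡) (sym πb≡) (s<s i<j) , subst₂ _<_ (sym πb≡) (sym πc≡) (s<s j<l)
    from : Occurs Shape231 π → Occurs Shape312 π
    from (i , j , l , i<j , j<l , l< , πl<πi , πi<πj)
      with a , πi≡ , _   , πa≡ ← position-of (<-trans i<j (<-trans j<l (<n l<)))
         | b , πj≡ , b<n , πb≡ ← position-of (<-trans j<l (<n l<))
         | c , πl≡ , _   , πc≡ ← position-of (<n l<) =
      c , a , b , s<s⁻¹ (subst₂ _<_ πl≡ πi≡ πl<πi) , s<s⁻¹ (subst₂ _<_ πi≡ πj≡ πi<πj) , <∣π∣ b<n ,
      subst₂ _<_ (sym πa≡) (sym πb≡) (s<s i<j) , subst₂ _<_ (sym πb≡) (sym πc≡) (s<s j<l)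

Is231or312 : List ℕ → Set
Is231or312 α = α ≡ 2 ∷ 3 ∷ 1 ∷ [] ⊎ α ≡ 3 ∷ 1 ∷ 2 ∷ []

contains⇔occurs231 : ∀ {α n π} → Is231or312 α → Involution n π → T (contains α π) ⇔ Occurs Shape231 π
contains⇔occurs231 (inj₁ refl) π-inv = contains231⇔ π-inv
contains⇔occurs231 (inj₂ refl) π-inv = ⇔.trans (contains312⇔ π-inv) (occurs312⇔occurs231 π-inv)

-- Direct sums and layered involutions

<⊎≡+ : ∀ a i → i < a ⊎ ∃[ j ] i ≡ a + j
<⊎≡+ zero    i       = inj₂ (i , refl)
<⊎≡+ (suc a) zero    = inj₁ z<s
<⊎≡+ (suc a) (suc i) with <⊎≡+ a i
... | inj₁ i<a       = inj₁ (s<s i<a)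
... | inj₂ (j , refl) = inj₂ (j , refl)

infixr 5 _⊕_
_⊕_ : List ℕ → List ℕ → List ℕ
σ ⊕ τ = σ ++ map (length σ +_) τ

length-⊕ : ∀ σ τ → length (σ ⊕ τ) ≡ length σ + length τ
length-⊕ σ τ = trans (length-++ σ) (cong (length σ +_) (length-map _ τ))

⊕-⟨⟩ˡ : ∀ σ τ {i} → i < length σ → (σ ⊕ τ) ⟨ i ⟩ ≡ σ ⟨ i ⟩
⊕-⟨⟩ˡ σ τ = ⟨⟩-++ˡ σ _

⊕-⟨⟩ʳ : ∀ σ τ {j} → j < length τ → (σ ⊕ τ) ⟨ length σ + j ⟩ ≡ length σ + τ ⟨ j ⟩
⊕-⟨⟩ʳ σ τ {j} j< = trans (⟨⟩-++ʳ σ _ j) (⟨⟩-map _ τ j<)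

⊕-involution : ∀ {a b σ τ} → Involution a σ → Involution b τ → Involution (a + b) (σ ⊕ τ)
⊕-involution {σ = σ} {τ} σ-inv τ-inv
  with refl ← Involution.length≡ σ-inv | refl ← Involution.length≡ τ-inv =
  record { length≡ = length-⊕ σ τ ; involutive = involutive }
  where
  module σ = Involution σ-inv
  module τ = Involution τ-inv
  open ≡-Reasoning
  involutive : ∀ {i} → i < length σ + length τ → at (σ ⊕ τ) ((σ ⊕ τ) ⟨ i ⟩) ≡ suc i
  involutive {i} i< with <⊎≡+ (length σ) i
  ... | inj₁ i<a with v , σi≡ , v<a ← σ.entry i<a = begin
    at (σ ⊕ τ) ((σ ⊕ τ) ⟨ i ⟩) ≡⟨ cong (at (σ ⊕ τ)) (trans (⊕-⟨⟩ˡ σ τ i<a) σi≡) ⟩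
    (σ ⊕ τ) ⟨ v ⟩              ≡⟨ ⊕-⟨⟩ˡ σ τ v<a ⟩
    σ ⟨ v ⟩                    ≡⟨ σ.inverse i<a σi≡ ⟩
    suc i                      ∎
  ... | inj₂ (j , refl) with j<b ← +-cancelˡ-< (length σ) j _ i<
                         with w , τj≡ , w<b ← τ.entry j<b = begin
    at (σ ⊕ τ) ((σ ⊕ τ) ⟨ a + j ⟩)
      ≡⟨ cong (at (σ ⊕ τ)) (trans (⊕-⟨⟩ʳ σ τ j<b) (trans (cong (a +_) τj≡) (+-suc a w))) ⟩
    (σ ⊕ τ) ⟨ a + w ⟩              ≡⟨ ⊕-⟨⟩ʳ σ τ w<b ⟩
    a + τ ⟨ w ⟩                    ≡⟨ cong (a +_) (τ.inverse j<b τj≡) ⟩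
    a + suc j                      ≡⟨ +-suc a j ⟩
    suc (a + j)                    ∎
    where a = length σ

⊕-involution⁻ : ∀ {a b σ τ} → Involution a σ → Involution (a + b) (σ ⊕ τ) → Involution b τ
⊕-involution⁻ {σ = σ} {τ} σ-inv π-inv with refl ← Involution.length≡ σ-inv
  with refl ← +-cancelˡ-≡ (length σ) _ _ (trans (sym (length-⊕ σ τ)) (Involution.length≡ π-inv)) =
  record { length≡ = refl ; involutive = involutive }
  where
  module σ = Involution σ-inv
  module π = Involution π-inv
  a = length σ
  involutive : ∀ {j} → j < length τ → at τ (τ ⟨ j ⟩) ≡ suc j
  involutive {j} j<b with v , π⟨a+j⟩≡ , v< ← π.entry (+-monoʳ-< a j<b) with <⊎≡+ a v
  ... | inj₁ v<a with u , σv≡ , u<a ← σ.entry v<a = contradiction (subst (_< a) (sym a+j≡u) u<a) (m+n≮m a j)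
    where
    a+j≡u : a + j ≡ u
    a+j≡u = suc-injective (trans (sym (π.inverse (+-monoʳ-< a j<b) π⟨a+j⟩≡)) (trans (⊕-⟨⟩ˡ σ τ v<a) σv≡))
  ... | inj₂ (w , refl) = begin
    at τ (τ ⟨ j ⟩) ≡⟨ cong (at τ) τj≡ ⟩
    τ ⟨ w ⟩        ≡⟨ +-cancelˡ-≡ a _ _ (trans (sym (⊕-⟨⟩ʳ σ τ w<b))
                                          (trans (π.inverse (+-monoʳ-< a j<b) π⟨a+j⟩≡) (sym (+-suc a j)))) ⟩
    suc j          ∎
    where
    open ≡-Reasoning
    w<b = +-cancelˡ-< a w _ v<
    τj≡ : τ ⟨ j ⟩ ≡ suc w
    τj≡ = +-cancelˡ-≡ a _ _ (trans (sym (⊕-⟨⟩ʳ σ τ j<b)) (trans π⟨a+j⟩≡ (sym (+-suc a w))))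

Shape231-resp : ∀ {x y z x′ y′ z′} → x ≡ x′ → y ≡ y′ → z ≡ z′ → Shape231 x y z → Shape231 x′ y′ z′
Shape231-resp refl refl refl shape = shape

Shape231-+ : ∀ a {x y z} → Shape231 (a + x) (a + y) (a + z) ⇔ Shape231 x y z
Shape231-+ a = mk⇔ (λ (z<x , x<y) → +-cancelˡ-< a _ _ z<x , +-cancelˡ-< a _ _ x<y)
                   (λ (z<x , x<y) → +-monoʳ-< a z<x , +-monoʳ-< a x<y)

⊕-avoids231⁻ : ∀ σ τ → Avoids231 (σ ⊕ τ) → Avoids231 τ
⊕-avoids231⁻ σ τ avoids (i , j , l , i<j , j<l , l< , shape) =
  avoids (a + i , a + j , a + l , +-monoʳ-< a i<j , +-monoʳ-< a j<l ,
          subst (a + l <_) (sym (length-⊕ σ τ)) (+-monoʳ-< a l<) ,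
          Shape231-resp (sym (⊕-⟨⟩ʳ σ τ i<)) (sym (⊕-⟨⟩ʳ σ τ j<)) (sym (⊕-⟨⟩ʳ σ τ l<))
                        (Equivalence.from (Shape231-+ a) shape))
  where
  a = length σ
  j< = <-trans j<l l<
  i< = <-trans i<j j<

-- 231 is sum-indecomposable: an occurrence in σ ⊕ τ lies entirely in σ or entirely in τ.
⊕-avoids231 : ∀ {a b σ τ} → Involution a σ → Involution b τ →
  Avoids231 σ → Avoids231 τ → Avoids231 (σ ⊕ τ)
⊕-avoids231 {σ = σ} {τ} σ-inv τ-inv σ-avoids τ-avoids (i , j , l , i<j , j<l , l< , shape)
  with refl ← Involution.length≡ σ-inv | refl ← Involution.length≡ τ-inv | <⊎≡+ (length σ) l
... | inj₁ l<a =
  σ-avoids (i , j , l , i<j , j<l , l<a ,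
            Shape231-resp (⊕-⟨⟩ˡ σ τ i<a) (⊕-⟨⟩ˡ σ τ (<-trans j<l l<a)) (⊕-⟨⟩ˡ σ τ l<a) shape)
  where i<a = <-trans i<j (<-trans j<l l<a)
... | inj₂ (l′ , refl)
  with l′< ← +-cancelˡ-< (length σ) l′ _ (subst (_ <_) (length-⊕ σ τ) l<) | <⊎≡+ (length σ) i
...   | inj₁ i<a with v , σi≡ , v<a ← Involution.entry σ-inv i<a
                 | w , τl′≡ , _ ← Involution.entry τ-inv l′< =
  <-asym (proj₁ shape) (begin-strict
    (σ ⊕ τ) ⟨ i ⟩           ≡⟨ trans (⊕-⟨⟩ˡ σ τ i<a) σi≡ ⟩
    suc v                   ≤⟨ v<a ⟩
    length σ                <⟨ m<m+n (length σ) z<s ⟩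
    length σ + suc w        ≡⟨ cong (length σ +_) τl′≡ ⟨
    length σ + τ ⟨ l′ ⟩     ≡⟨ ⊕-⟨⟩ʳ σ τ l′< ⟨
    (σ ⊕ τ) ⟨ length σ + l′ ⟩ ∎)
  where open ≤-Reasoning
...   | inj₂ (i′ , refl) with <⊎≡+ (length σ) j
...     | inj₁ j<a = <-asym i<j (≤-trans j<a (m≤m+n (length σ) i′))
...     | inj₂ (j′ , refl) =
  τ-avoids (i′ , j′ , l′ , +-cancelˡ-< a i′ j′ i<j , +-cancelˡ-< a j′ l′ j<l , l′< ,
            Equivalence.to (Shape231-+ a)
              (Shape231-resp (⊕-⟨⟩ʳ σ τ i′<) (⊕-⟨⟩ʳ σ τ j′<) (⊕-⟨⟩ʳ σ τ l′<) shape))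
  where
  a = length σ
  j′< = <-trans (+-cancelˡ-< a j′ l′ j<l) l′<
  i′< = <-trans (+-cancelˡ-< a i′ j′ i<j) j′<

decreasing : ℕ → List ℕ
decreasing = applyDownFrom suc

⟨⟩-decreasing : ∀ {s i} → i < s → decreasing s ⟨ i ⟩ ≡ s ∸ i
⟨⟩-decreasing {suc s} {zero}  _         = refl
⟨⟩-decreasing {suc s} {suc i} (s<s i<s) = ⟨⟩-decreasing i<s

decreasing-involution : ∀ s → Involution s (decreasing s)
decreasing-involution s = record { length≡ = length-applyDownFrom suc s ; involutive = involutive }
  where
  involutive : ∀ {i} → i < s → at (decreasing s) (decreasing s ⟨ i ⟩) ≡ suc i
  involutive {i} i<s = begin
    at (decreasing s) (decreasing s ⟨ i ⟩) ≡⟨ cong (at (decreasing s)) (trans (⟨⟩-decreasing i<s) s∸i≡) ⟩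
    decreasing s ⟨ s ∸ suc i ⟩            ≡⟨ ⟨⟩-decreasing (∸-monoʳ-< z<s i<s) ⟩
    s ∸ (s ∸ suc i)                        ≡⟨ m∸[m∸n]≡n i<s ⟩
    suc i                                  ∎
    where
    open ≡-Reasoning
    s∸i≡ : s ∸ i ≡ suc (s ∸ suc i)
    s∸i≡ = +-∸-assoc 1 i<s

decreasing-avoids231 : ∀ s → Avoids231 (decreasing s)
decreasing-avoids231 s (i , j , l , i<j , j<l , l< , _ , πi<πj) =
  <-asym πi<πj (subst₂ _<_ (sym (⟨⟩-decreasing j<s)) (sym (⟨⟩-decreasing i<s)) (∸-monoʳ-< i<j (<⇒≤ j<s)))
  where
  j<s = subst (j <_) (length-applyDownFrom suc s) (<-trans j<l l<)
  i<s = <-trans i<j j<s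

-- Compositions are lists of parts, the entry p standing for a part of size suc p.
size : List ℕ → ℕ
size c = sum (map suc c)

layered : List ℕ → List ℕ
layered []      = []
layered (p ∷ c) = decreasing (suc p) ⊕ layered c

layered-involution : ∀ c → Involution (size c) (layered c)
layered-involution []      = record { length≡ = refl ; involutive = λ () }
layered-involution (p ∷ c) = ⊕-involution (decreasing-involution (suc p)) (layered-involution c)

layered-avoids231 : ∀ c → Avoids231 (layered c)
layered-avoids231 []      (_ , _ , _ , _ , _ , () , _)
layered-avoids231 (p ∷ c) =
  ⊕-avoids231 (decreasing-involution (suc p)) (layered-involution c) (decreasing-avoids231 (suc p)) (layered-avoids231 c)

layered-injective : ∀ {c d} → layered c ≡ layered d → c ≡ d
layered-injective {[]}    {[]}    _  = refl
layered-injective {p ∷ c} {q ∷ d} eq with refl , tails ← ∷-injective eq =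
  cong (p ∷_) (layered-injective
    (map-injective (+-cancelˡ-≡ (length (decreasing (suc p))) _ _) (++-cancelˡ (decreasing p) _ _ tails)))

-- f i + i is non-increasing, equal to suc p at both ends, hence constant.
strictlyDecreasing-squeeze : ∀ (f : ℕ → ℕ) p → (∀ {i} → i < p → f (suc i) < f i) →
  f 0 ≡ suc p → 1 ≤ f p → ∀ {i} → i ≤ p → f i ≡ suc p ∸ i
strictlyDecreasing-squeeze f p f-dec f0≡ 1≤fp {i} i≤p =
  trans (sym (m+n∸n≡m (f i) i)) (cong (_∸ i) (≤-antisym upper lower))
  where
  mono : ∀ {i j} → i ≤ j → j ≤ p → f j + j ≤ f i + i
  mono {i} {zero}  z≤n _ = ≤-refl
  mono {i} {suc j} i≤1+j 1+j≤p with m≤n⇒m<n∨m≡n i≤1+j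
  ... | inj₂ refl      = ≤-refl
  ... | inj₁ (s≤s i≤j) = begin
    f (suc j) + suc j    ≡⟨ +-suc (f (suc j)) j ⟩
    suc (f (suc j) + j)  ≤⟨ +-monoˡ-≤ j (f-dec 1+j≤p) ⟩
    f j + j              ≤⟨ mono i≤j (<⇒≤ 1+j≤p) ⟩
    f i + i              ∎
    where open ≤-Reasoning
  upper : f i + i ≤ suc p
  upper = subst (f i + i ≤_) (trans (+-identityʳ (f 0)) f0≡) (mono z≤n i≤p)
  lower : suc p ≤ f i + i
  lower = ≤-trans (+-monoˡ-≤ p 1≤fp) (mono i≤p ≤-refl)

module FirstBlock {n π} (π-inv : Involution (suc n) π) (avoids : Avoids231 π)
                   {p} (π⟨0⟩≡ : π ⟨ 0 ⟩ ≡ suc p) (p<n : p < suc n) where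
  open Involution π-inv

  private
    s = suc p

  π⟨p⟩≡1 : π ⟨ p ⟩ ≡ 1
  π⟨p⟩≡1 = inverse z<s π⟨0⟩≡

  1<π⟨_⟩ : ∀ {i} → i < p → 1 < π ⟨ i ⟩
  1<π⟨_⟩ {i} i<p with v , πi≡ , _ ← entry (<-trans i<p p<n) =
    ≤∧≢⇒< (subst (1 ≤_) (sym πi≡) (s≤s z≤n))
           (λ 1≡πi → <⇒≢ i<p (injective (<-trans i<p p<n) p<n (trans (sym 1≡πi) (sym π⟨p⟩≡1))))

  descends : ∀ {i} → i < p → π ⟨ suc i ⟩ < π ⟨ i ⟩
  descends {i} i<p with m≤n⇒m<n∨m≡n i<p
  ... | inj₂ refl = subst (_< π ⟨ i ⟩) (sym π⟨p⟩≡1) 1<π⟨ i<p ⟩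
  ... | inj₁ 1+i<p with <-cmp (π ⟨ i ⟩) (π ⟨ suc i ⟩)
  ...   | tri> _ _ πi>πj = πi>πj
  ...   | tri≈ _ πi≡πj _ = contradiction (injective (<-trans i<p p<n) (<-trans 1+i<p p<n) πi≡πj) (1+n≢n ∘ sym)
  ...   | tri< πi<πj _ _ =
    contradiction (i , suc i , p , n<1+n i , 1+i<p , subst (p <_) (sym length≡) p<n ,
                   subst (_< π ⟨ i ⟩) (sym π⟨p⟩≡1) 1<π⟨ i<p ⟩ , πi<πj) avoids

  below : ∀ {i} → i < s → π ⟨ i ⟩ ≡ s ∸ i
  below i<s = strictlyDecreasing-squeeze (π ⟨_⟩) p descends π⟨0⟩≡ (≤-reflexive (sym π⟨p⟩≡1)) (s≤s⁻¹ i<s)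

  above : ∀ {j} → s + j < suc n → s ≤ π ⟨ s + j ⟩
  above {j} s+j<n with v , π⟨s+j⟩≡ , _ ← entry s+j<n with <⊎≡+ s v
  ... | inj₂ (w , refl) = subst (s ≤_) (sym π⟨s+j⟩≡) (m≤n⇒m≤1+n (m≤m+n s w))
  ... | inj₁ v<s = contradiction (begin-strict
    s              ≤⟨ m≤m+n s j ⟩
    s + j          <⟨ n<1+n (s + j) ⟩
    suc (s + j)    ≡⟨ inverse s+j<n π⟨s+j⟩≡ ⟨
    π ⟨ v ⟩        ≡⟨ below v<s ⟩
    s ∸ v          ∎) (≤⇒≯ (m∸n≤m s v))
    where open ≤-Reasoning

  private
    τ = map (_∸ s) (drop s π)
    σ = decreasing s

    length-τ : length τ ≡ suc n ∸ s
    length-τ = trans (length-map _ (drop s π)) (trans (length-drop s π) (cong (_∸ s) length≡))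

    length-σ⊕τ : length (σ ⊕ τ) ≡ suc n
    length-σ⊕τ = trans (length-⊕ σ τ) (trans (cong₂ _+_ (length-applyDownFrom suc s) length-τ) (m+[n∸m]≡n p<n))

  split-off : π ≡ σ ⊕ τ
  split-off = ⟨⟩-ext (trans length≡ (sym length-σ⊕τ)) entries
    where
    entries : ∀ {i} → i < length π → π ⟨ i ⟩ ≡ (σ ⊕ τ) ⟨ i ⟩
    entries {i} i< with <⊎≡+ s i
    ... | inj₁ i<s =
      trans (below i<s)
            (sym (trans (⊕-⟨⟩ˡ σ τ (subst (i <_) (sym (length-applyDownFrom suc s)) i<s)) (⟨⟩-decreasing i<s)))
    ... | inj₂ (j , refl) = sym (begin
      (σ ⊕ τ) ⟨ s + j ⟩              ≡⟨ cong (λ a → (σ ⊕ τ) ⟨ a + j ⟩) (sym (length-applyDownFrom suc s)) ⟩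
      (σ ⊕ τ) ⟨ length σ + j ⟩       ≡⟨ ⊕-⟨⟩ʳ σ τ j<τ ⟩
      length σ + τ ⟨ j ⟩             ≡⟨ cong₂ _+_ (length-applyDownFrom suc s) (⟨⟩-map (_∸ s) (drop s π) j<drop) ⟩
      s + (drop s π ⟨ j ⟩ ∸ s)       ≡⟨ cong (λ x → s + (x ∸ s)) (⟨⟩-drop s π j) ⟩
      s + (π ⟨ s + j ⟩ ∸ s)          ≡⟨ m+[n∸m]≡n (above s+j<n) ⟩
      π ⟨ s + j ⟩                    ∎)
      where
      open ≡-Reasoning
      s+j<n = subst (s + j <_) length≡ i<
      j<τ : j < length τ
      j<τ = subst (j <_) (sym length-τ) (m+n≤o⇒m≤o∸n (suc j) (subst (_≤ suc n) (cong suc (+-comm s j)) s+j<n))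
      j<drop = subst (j <_) (length-map _ (drop s π)) j<τ

first-block : ∀ {n π} → Involution (suc n) π → Avoids231 π →
  ∃[ p ] p < suc n × π ≡ decreasing (suc p) ⊕ map (_∸ suc p) (drop (suc p) π)
first-block π-inv avoids with p , π⟨0⟩≡ , p<n ← Involution.entry π-inv z<s =
  p , p<n , FirstBlock.split-off π-inv avoids π⟨0⟩≡ p<n

avoiding⇒layered : ∀ {n π} → Involution n π → Avoids231 π → ∃[ c ] size c ≡ n × π ≡ layered c
avoiding⇒layered = go (<-wellFounded _)
  where
  go : ∀ {n π} → Acc _<_ n → Involution n π → Avoids231 π → ∃[ c ] size c ≡ n × π ≡ layered c
  go {zero}  {[]}    _         _     _      = [] , refl , refl
  go {zero}  {_ ∷ _} _         π-inv _      with () ← Involution.length≡ π-inv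
  go {suc n} {π}     (acc rec) π-inv avoids with p , p<n , π≡ ← first-block π-inv avoids =
    extend (go (rec (s≤s (m∸n≤m n p))) τ-inv τ-avoids)
    where
    τ = map (_∸ suc p) (drop (suc p) π)
    n≡ : suc p + (n ∸ p) ≡ suc n
    n≡ = m+[n∸m]≡n p<n
    τ-inv : Involution (n ∸ p) τ
    τ-inv = ⊕-involution⁻ (decreasing-involution (suc p)) (subst₂ Involution (sym n≡) π≡ π-inv)
    τ-avoids : Avoids231 τ
    τ-avoids = ⊕-avoids231⁻ (decreasing (suc p)) τ (subst Avoids231 π≡ avoids)
    extend : ∃[ c ] size c ≡ n ∸ p × τ ≡ layered c → ∃[ c ] size c ≡ suc n × π ≡ layered c
    extend (c , size-c , τ≡) =
      p ∷ c , trans (cong (suc p +_) size-c) n≡ , trans π≡ (cong (decreasing (suc p) ⊕_) τ≡)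

-- Fixed points

count : (A → Bool) → List A → ℕ
count p xs = length (filterᵇ p xs)

count-∷ : ∀ (p : A → Bool) x xs → count p (x ∷ xs) ≡ (if p x then 1 else 0) + count p xs
count-∷ p x xs with p x
... | true  = refl
... | false = refl

count-map : ∀ (p : B → Bool) (f : A → B) xs → count p (map f xs) ≡ count (λ x → p (f x)) xs
count-map p f []       = refl
count-map p f (x ∷ xs) =
  trans (count-∷ p (f x) (map f xs)) (trans (cong (_ +_) (count-map p f xs)) (sym (count-∷ _ x xs)))

count-cong : ∀ (p q : A → Bool) xs → (∀ {x} → x ∈ xs → p x ≡ q x) → count p xs ≡ count q xs
count-cong p q []       _    = refl
count-cong p q (x ∷ xs) p≗q = begin
  count p (x ∷ xs)                          ≡⟨ count-∷ p x xs ⟩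
  (if p x then 1 else 0) + count p xs
    ≡⟨ cong₂ (λ b n → (if b then 1 else 0) + n) (p≗q (here refl)) (count-cong p q xs (p≗q ∘ there)) ⟩
  (if q x then 1 else 0) + count q xs       ≡⟨ count-∷ q x xs ⟨
  count q (x ∷ xs)                          ∎
  where
  open ≡-Reasoning

-- The fixed points of w when it is read as the entries at positions q+1, q+2, … of a longer word.
fixedFrom : ℕ → List ℕ → ℕ
fixedFrom q []       = 0
fixedFrom q (x ∷ xs) = (if x ≡ᵇ suc q then 1 else 0) + fixedFrom (suc q) xs

count-fixed≡fixedFrom : ∀ q w → count (λ i → at w i ≡ᵇ q + i) (range1 (length w)) ≡ fixedFrom q w
count-fixed≡fixedFrom q []       = refl
count-fixed≡fixedFrom q (x ∷ xs) = begin
  count P (1 ∷ applyUpTo (λ i → suc (suc i)) n)                 ≡⟨ count-∷ P 1 _ ⟩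
  (if x ≡ᵇ q + 1 then 1 else 0) + count P (applyUpTo (λ i → suc (suc i)) n)
    ≡⟨ cong₂ (λ a l → (if x ≡ᵇ a then 1 else 0) + count P l) (+-comm q 1) (sym (map-applyUpTo suc suc n)) ⟩
  (if x ≡ᵇ suc q then 1 else 0) + count P (map suc (range1 n))   ≡⟨ cong (_ +_) (count-map P suc (range1 n)) ⟩
  (if x ≡ᵇ suc q then 1 else 0) + count (λ i → P (suc i)) (range1 n)
    ≡⟨ cong (_ +_) (count-cong _ _ (range1 n) shift) ⟩
  (if x ≡ᵇ suc q then 1 else 0) + count (λ i → at xs i ≡ᵇ suc q + i) (range1 n)
    ≡⟨ cong (_ +_) (count-fixed≡fixedFrom (suc q) xs) ⟩
  fixedFrom q (x ∷ xs)                                           ∎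
  where
  open ≡-Reasoning
  n = length xs
  P : ℕ → Bool
  P i = at (x ∷ xs) i ≡ᵇ q + i
  shift : ∀ {i} → i ∈ range1 n → P (suc i) ≡ (at xs i ≡ᵇ suc q + i)
  shift i∈ with i , refl , _ ← ∈-range1⁻ i∈ = cong (at xs (suc i) ≡ᵇ_) (+-suc q (suc i))

fixedPoints≡fixedFrom : ∀ {n} w → length w ≡ n → fixedPoints n w ≡ fixedFrom 0 w
fixedPoints≡fixedFrom w refl = count-fixed≡fixedFrom 0 w

fixedFrom-++ : ∀ q xs ys → fixedFrom q (xs ++ ys) ≡ fixedFrom q xs + fixedFrom (length xs + q) ys
fixedFrom-++ q []       ys = refl
fixedFrom-++ q (x ∷ xs) ys = begin
  b + fixedFrom (suc q) (xs ++ ys)                              ≡⟨ cong (b +_) (fixedFrom-++ (suc q) xs ys) ⟩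
  b + (fixedFrom (suc q) xs + fixedFrom (length xs + suc q) ys)
    ≡⟨ cong (λ a → b + (fixedFrom (suc q) xs + fixedFrom a ys)) (+-suc (length xs) q) ⟩
  b + (fixedFrom (suc q) xs + fixedFrom (suc (length xs + q)) ys) ≡⟨ +-assoc b _ _ ⟨
  b + fixedFrom (suc q) xs + fixedFrom (suc (length xs + q)) ys ∎
  where
  open ≡-Reasoning
  b = if x ≡ᵇ suc q then 1 else 0

≡ᵇ-+ : ∀ s x y → (s + x ≡ᵇ s + y) ≡ (x ≡ᵇ y)
≡ᵇ-+ zero    x y = refl
≡ᵇ-+ (suc s) x y = ≡ᵇ-+ s x y

fixedFrom-shift : ∀ s q ys → fixedFrom (s + q) (map (s +_) ys) ≡ fixedFrom q ys
fixedFrom-shift s q []       = refl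
fixedFrom-shift s q (y ∷ ys) = cong₂ (λ b n → (if b then 1 else 0) + n)
  (trans (cong (s + y ≡ᵇ_) (sym (+-suc s q))) (≡ᵇ-+ s y (suc q)))
  (trans (cong (λ a → fixedFrom a (map (s +_) ys)) (sym (+-suc s q))) (fixedFrom-shift s (suc q) ys))

fixedFrom-⊕ : ∀ q σ τ → fixedFrom q (σ ⊕ τ) ≡ fixedFrom q σ + fixedFrom q τ
fixedFrom-⊕ q σ τ = trans (fixedFrom-++ q σ _) (cong (fixedFrom q σ +_) (fixedFrom-shift (length σ) q τ))

≢⇒≡ᵇ≡false : ∀ {x y} → x ≢ y → (x ≡ᵇ y) ≡ false
≢⇒≡ᵇ≡false {x} {y} x≢y with x ≡ᵇ y in eq
... | false = refl
... | true  = contradiction (≡ᵇ⇒≡ x y (subst T (sym eq) _)) x≢y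

fixedFrom-decreasing≡0 : ∀ {s q} → s ≤ q → fixedFrom q (decreasing s) ≡ 0
fixedFrom-decreasing≡0 {zero}  _   = refl
fixedFrom-decreasing≡0 {suc s} s<q rewrite ≢⇒≡ᵇ≡false (<⇒≢ s<q) =
  fixedFrom-decreasing≡0 (m≤n⇒m≤1+n (<⇒≤ s<q))

oddBlock : ℕ → ℕ
oddBlock zero          = 1
oddBlock (suc zero)    = 0
oddBlock (suc (suc p)) = oddBlock p

≡ᵇ-refl : ∀ q → (q ≡ᵇ q) ≡ true
≡ᵇ-refl zero    = refl
≡ᵇ-refl (suc q) = ≡ᵇ-refl q

fixedFrom-decreasing : ∀ d q → fixedFrom q (decreasing (suc d + q)) ≡ oddBlock d
fixedFrom-decreasing zero          q rewrite ≡ᵇ-refl q = cong suc (fixedFrom-decreasing≡0 {q} {suc q} (n≤1+n q))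
fixedFrom-decreasing (suc zero)    q rewrite ≢⇒≡ᵇ≡false (1+n≢n {q}) = fixedFrom-decreasing≡0 {suc q} ≤-refl
fixedFrom-decreasing (suc (suc d)) q rewrite ≢⇒≡ᵇ≡false (>⇒≢ (s≤s (m≤n⇒m≤1+n (m≤n+m q d)))) =
  trans (cong (λ a → fixedFrom (suc q) (decreasing (suc a))) (sym (+-suc d q))) (fixedFrom-decreasing d (suc q))

oddParts : List ℕ → ℕ
oddParts c = sum (map oddBlock c)

fixedFrom-layered : ∀ c → fixedFrom 0 (layered c) ≡ oddParts c
fixedFrom-layered []      = refl
fixedFrom-layered (p ∷ c) = begin
  fixedFrom 0 (decreasing (suc p) ⊕ layered c)                 ≡⟨ fixedFrom-⊕ 0 (decreasing (suc p)) (layered c) ⟩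
  fixedFrom 0 (decreasing (suc p)) + fixedFrom 0 (layered c)   ≡⟨ cong₂ _+_ block (fixedFrom-layered c) ⟩
  oddBlock p + oddParts c                                      ∎
  where
  open ≡-Reasoning
  block : fixedFrom 0 (decreasing (suc p)) ≡ oddBlock p
  block = trans (cong (λ s → fixedFrom 0 (decreasing s)) (sym (+-identityʳ (suc p)))) (fixedFrom-decreasing p 0)

fixedPoints-layered : ∀ {n} c → length (layered c) ≡ n → fixedPoints n (layered c) ≡ oddParts c
fixedPoints-layered c len = trans (fixedPoints≡fixedFrom (layered c) len) (fixedFrom-layered c)

-- Compositions by number of odd parts

pairBlock : ℕ → ℕ
pairBlock zero          = 0
pairBlock (suc zero)    = 1
pairBlock (suc (suc p)) = suc (pairBlock p)

pairs : List ℕ → ℕ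
pairs c = sum (map pairBlock c)

size≡oddParts+2*pairs : ∀ c → size c ≡ oddParts c + 2 * pairs c
size≡oddParts+2*pairs []      = refl
size≡oddParts+2*pairs (p ∷ c) = begin
  suc p + size c                                        ≡⟨ cong₂ _+_ (block p) (size≡oddParts+2*pairs c) ⟩
  (oddBlock p + 2 * pairBlock p) + (oddParts c + 2 * pairs c)
    ≡⟨ solve 4 (λ o b o′ b′ → (o :+ con 2 :* b) :+ (o′ :+ con 2 :* b′) := (o :+ o′) :+ con 2 :* (b :+ b′)) refl
             (oddBlock p) (pairBlock p) (oddParts c) (pairs c) ⟩
  oddParts (p ∷ c) + 2 * pairs (p ∷ c)                  ∎
  where
  open ≡-Reasoning
  open +-*-Solver
  block : ∀ p → suc p ≡ oddBlock p + 2 * pairBlock p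
  block zero          = refl
  block (suc zero)    = refl
  block (suc (suc p)) = trans (cong (suc ∘ suc) (block p))
    (solve 2 (λ o b → con 2 :+ (o :+ con 2 :* b) := o :+ con 2 :* (con 1 :+ b)) refl (oddBlock p) (pairBlock p))

2∣size+oddParts : ∀ c → 2 ∣ size c + oddParts c
2∣size+oddParts c = divides (oddParts c + pairs c) (begin
  size c + oddParts c                 ≡⟨ cong (_+ oddParts c) (size≡oddParts+2*pairs c) ⟩
  oddParts c + 2 * pairs c + oddParts c
    ≡⟨ solve 2 (λ o p → o :+ con 2 :* p :+ o := (o :+ p) :* con 2) refl (oddParts c) (pairs c) ⟩
  (oddParts c + pairs c) * 2          ∎)
  where
  open ≡-Reasoning
  open +-*-Solver

record Profile (m k : ℕ) (c : List ℕ) : Set where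
  constructor profile
  field
    pairs≡    : pairs c ≡ m
    oddParts≡ : oddParts c ≡ k

add-odd : ∀ {m k c} → Profile m k c → Profile m (suc k) (0 ∷ c)
add-odd (profile pc oc) = profile pc (cong suc oc)

add-pair : ∀ {m k c} → Profile m k c → Profile (suc m) k (1 ∷ c)
add-pair (profile pc oc) = profile (cong suc pc) oc

-- Only nonempty compositions are grown; `grow [] = []` just keeps `grow` injective.
grow : List ℕ → List ℕ
grow []      = []
grow (p ∷ c) = suc (suc p) ∷ c

-- The compositions of k + 2m with k odd parts, listed by their first part: 1, 2, or at least 3
-- (the first part of a composition of k + 2(m − 1) grown by 2).
compositions : ℕ → ℕ → List (List ℕ)
compositions zero          zero    = [ [] ]
compositions zero          (suc k) = map (0 ∷_) (compositions zero k)
compositions (suc m)       (suc k) =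
  map (0 ∷_) (compositions (suc m) k) ++ map (1 ∷_) (compositions m (suc k)) ++ map grow (compositions m (suc k))
compositions (suc zero)    zero    = [ 1 ∷ [] ]
compositions (suc (suc m)) zero    = map (1 ∷_) (compositions (suc m) zero) ++ map grow (compositions (suc m) zero)

∈-compositions⁺ : ∀ c → c ∈ compositions (pairs c) (oddParts c)
∈-compositions⁺ [] = here refl
∈-compositions⁺ (zero ∷ c) with pairs c | ∈-compositions⁺ c
... | zero  | c∈ = ∈-map⁺ (0 ∷_) c∈
... | suc m | c∈ = ∈-++⁺ˡ (∈-map⁺ (0 ∷_) c∈)
∈-compositions⁺ (suc zero ∷ c) with pairs c | oddParts c | ∈-compositions⁺ c
... | zero  | zero  | here refl = here refl
... | suc m | zero  | c∈ = ∈-++⁺ˡ (∈-map⁺ (1 ∷_) c∈)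
... | m     | suc k | c∈ = ∈-++⁺ʳ (map (0 ∷_) (compositions (suc m) k)) (∈-++⁺ˡ (∈-map⁺ (1 ∷_) c∈))
∈-compositions⁺ (suc (suc p) ∷ c) with pairs (p ∷ c) | oddParts (p ∷ c) | ∈-compositions⁺ (p ∷ c)
... | zero  | zero  | here ()
... | zero  | zero  | there ()
... | suc m | zero  | c∈ = ∈-++⁺ʳ (map (1 ∷_) (compositions (suc m) zero)) (∈-map⁺ grow c∈)
... | m     | suc k | c∈ =
  ∈-++⁺ʳ (map (0 ∷_) (compositions (suc m) k)) (∈-++⁺ʳ (map (1 ∷_) (compositions m (suc k))) (∈-map⁺ grow c∈))

compositions-profile : ∀ m k → All (Profile m k) (compositions m k)
compositions-profile zero          zero    = profile refl refl ∷ []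
compositions-profile zero          (suc k) = All.map⁺ (All.map add-odd (compositions-profile zero k))
compositions-profile (suc m)       (suc k) =
  All.++⁺ (All.map⁺ (All.map add-odd (compositions-profile (suc m) k)))
          (All.++⁺ (All.map⁺ (All.map add-pair (compositions-profile m (suc k))))
                   (All.map⁺ (All.map grow-profile (compositions-profile m (suc k)))))
  where
  grow-profile : ∀ {c} → Profile m (suc k) c → Profile (suc m) (suc k) (grow c)
  grow-profile {p ∷ c} (profile pc oc) = profile (cong suc pc) oc
compositions-profile (suc zero)    zero    = profile refl refl ∷ []
compositions-profile (suc (suc m)) zero    =
  All.++⁺ (All.map⁺ (All.map add-pair (compositions-profile (suc m) zero)))
          (All.map⁺ (All.map grow-profile (compositions-profile (suc m) zero)))
  where
  grow-profile : ∀ {c} → Profile (suc m) zero c → Profile (suc (suc m)) zero (grow c)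
  grow-profile {p ∷ c} (profile pc oc) = profile (cong suc pc) oc

∈-compositions⇔ : ∀ m k {c} → c ∈ compositions m k ⇔ (size c ≡ k + 2 * m × oddParts c ≡ k)
∈-compositions⇔ m k {c} = mk⇔ to from
  where
  to : c ∈ compositions m k → size c ≡ k + 2 * m × oddParts c ≡ k
  to c∈ with profile pairs≡ oddParts≡ ← All.lookup (compositions-profile m k) c∈ =
    trans (size≡oddParts+2*pairs c) (cong₂ (λ o p → o + 2 * p) oddParts≡ pairs≡) , oddParts≡
  from : size c ≡ k + 2 * m × oddParts c ≡ k → c ∈ compositions m k
  from (size≡ , oddParts≡) = subst₂ (λ m k → c ∈ compositions m k) pairs≡ oddParts≡ (∈-compositions⁺ c)
    where
    pairs≡ : pairs c ≡ m
    pairs≡ = *-cancelˡ-≡ _ _ 2 (+-cancelˡ-≡ k _ _ (begin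
      k + 2 * pairs c           ≡⟨ cong (_+ 2 * pairs c) oddParts≡ ⟨
      oddParts c + 2 * pairs c  ≡⟨ size≡oddParts+2*pairs c ⟨
      size c                    ≡⟨ size≡ ⟩
      k + 2 * m                 ∎))
      where open ≡-Reasoning

grow-injective : ∀ {c d} → grow c ≡ grow d → c ≡ d
grow-injective {[]}    {[]}    _    = refl
grow-injective {p ∷ c} {q ∷ d} refl = refl

map-disjoint : ∀ {A B : Set} {f g : A → B} {xs ys} → (∀ x y → f x ≢ g y) → Disjoint (map f xs) (map g ys)
map-disjoint {f = f} {g} f≢g (v∈f , v∈g) with x , _ , refl ← ∈-map⁻ f v∈f with y , _ , eq ← ∈-map⁻ g v∈g =
  f≢g x y eq

disjoint-++ : ∀ {A : Set} {xs} (ys : List A) {zs} → Disjoint xs ys → Disjoint xs zs → Disjoint xs (ys ++ zs)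
disjoint-++ ys xs#ys xs#zs (v∈xs , v∈ys++zs) =
  [ (λ v∈ys → xs#ys (v∈xs , v∈ys)) , (λ v∈zs → xs#zs (v∈xs , v∈zs)) ]′ (∈-++⁻ ys v∈ys++zs)

0∷≢grow : ∀ c d → 0 ∷ c ≢ grow d
0∷≢grow c []      ()
0∷≢grow c (p ∷ d) ()

1∷≢grow : ∀ c d → 1 ∷ c ≢ grow d
1∷≢grow c []      ()
1∷≢grow c (p ∷ d) ()

compositions-unique : ∀ m k → Unique (compositions m k)
compositions-unique zero          zero    = [] ∷ []
compositions-unique zero          (suc k) = Unique.map⁺ ∷-injectiveʳ (compositions-unique zero k)
compositions-unique (suc m)       (suc k) =
  Unique.++⁺ (Unique.map⁺ ∷-injectiveʳ (compositions-unique (suc m) k))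
             (Unique.++⁺ (Unique.map⁺ ∷-injectiveʳ (compositions-unique m (suc k)))
                         (Unique.map⁺ grow-injective (compositions-unique m (suc k)))
                         (map-disjoint 1∷≢grow))
             (disjoint-++ (map (1 ∷_) (compositions m (suc k))) (map-disjoint λ _ _ ()) (map-disjoint 0∷≢grow))
compositions-unique (suc zero)    zero    = [] ∷ []
compositions-unique (suc (suc m)) zero    =
  Unique.++⁺ (Unique.map⁺ ∷-injectiveʳ (compositions-unique (suc m) zero))
             (Unique.map⁺ grow-injective (compositions-unique (suc m) zero))
             (map-disjoint 1∷≢grow)

binomials : ℕ → ℕ → ℕ
binomials m k = (k + m) C m + (k + m ∸ 1) C m

binomials-suc-zero : ∀ m → binomials (suc m) 0 ≡ 1
binomials-suc-zero m = cong₂ _+_ (nCn≡1 (suc m)) (k>n⇒nCk≡0 (n<1+n m))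

binomials-pascal : ∀ m k → binomials (suc m) k + binomials m (suc k) ≡ binomials (suc m) (suc k)
binomials-pascal m k rewrite +-suc k m = begin
  (suc a C suc m + a C suc m) + (suc a C m + a C m)
    ≡⟨ solve 4 (λ w x y z → (w :+ x) :+ (y :+ z) := (y :+ w) :+ (z :+ x)) refl
               (suc a C suc m) (a C suc m) (suc a C m) (a C m) ⟩
  (suc a C m + suc a C suc m) + (a C m + a C suc m)
    ≡⟨ cong₂ _+_ (nCk+nC[k+1]≡[n+1]C[k+1] (suc a) m) (nCk+nC[k+1]≡[n+1]C[k+1] a m) ⟩
  suc (suc a) C suc m + suc a C suc m               ∎
  where
  open ≡-Reasoning
  open +-*-Solver
  a = k + m

length-compositions-zero : ∀ k → length (compositions zero k) ≡ 1
length-compositions-zero zero    = refl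
length-compositions-zero (suc k) = trans (length-map _ (compositions zero k)) (length-compositions-zero k)

length-compositions-suc-zero : ∀ m → length (compositions (suc (suc m)) 0) ≡ 2 * length (compositions (suc m) 0)
length-compositions-suc-zero m = begin
  length (map (1 ∷_) cs ++ map grow cs)  ≡⟨ length-++ (map (1 ∷_) cs) ⟩
  length (map (1 ∷_) cs) + length (map grow cs) ≡⟨ cong₂ _+_ (length-map _ cs) (length-map _ cs) ⟩
  length cs + length cs                  ≡⟨ cong (length cs +_) (+-identityʳ (length cs)) ⟨
  2 * length cs                          ∎
  where
  open ≡-Reasoning
  cs = compositions (suc m) zero

length-compositions-suc-suc : ∀ m k →
  length (compositions (suc m) (suc k)) ≡ length (compositions (suc m) k) + 2 * length (compositions m (suc k))
length-compositions-suc-suc m k = begin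
  length (map (0 ∷_) cs₁ ++ map (1 ∷_) cs₂ ++ map grow cs₂)
    ≡⟨ trans (length-++ (map (0 ∷_) cs₁)) (cong (length (map (0 ∷_) cs₁) +_) (length-++ (map (1 ∷_) cs₂))) ⟩
  length (map (0 ∷_) cs₁) + (length (map (1 ∷_) cs₂) + length (map grow cs₂))
    ≡⟨ cong₂ _+_ (length-map _ cs₁) (cong₂ _+_ (length-map _ cs₂) (length-map _ cs₂)) ⟩
  length cs₁ + (length cs₂ + length cs₂)
    ≡⟨ cong (λ x → length cs₁ + (length cs₂ + x)) (+-identityʳ (length cs₂)) ⟨
  length cs₁ + 2 * length cs₂ ∎
  where
  open ≡-Reasoning
  cs₁ = compositions (suc m) k
  cs₂ = compositions m (suc k)

length-compositions : ∀ m k → 1 ≤ k + m → 2 * length (compositions m k) ≡ 2 ^ m * binomials m k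
length-compositions zero          (suc k) _ rewrite length-compositions-zero (suc k) = refl
length-compositions (suc zero)    zero    _ = refl
length-compositions (suc (suc m)) zero    _ = begin
  2 * length (compositions (suc (suc m)) 0)    ≡⟨ cong (2 *_) (length-compositions-suc-zero m) ⟩
  2 * (2 * length (compositions (suc m) 0))    ≡⟨ cong (2 *_) (length-compositions (suc m) zero (s≤s z≤n)) ⟩
  2 * (2 ^ suc m * binomials (suc m) 0)
    ≡⟨ cong (λ b → 2 * (2 ^ suc m * b)) (trans (binomials-suc-zero m) (sym (binomials-suc-zero (suc m)))) ⟩
  2 * (2 ^ suc m * binomials (suc (suc m)) 0)  ≡⟨ *-assoc 2 (2 ^ suc m) _ ⟨
  2 ^ suc (suc m) * binomials (suc (suc m)) 0  ∎
  where open ≡-Reasoning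
length-compositions (suc m)       (suc k) _ = begin
  2 * length (compositions (suc m) (suc k))  ≡⟨ cong (2 *_) (length-compositions-suc-suc m k) ⟩
  2 * (ℓ₁ + 2 * ℓ₂)                          ≡⟨ *-distribˡ-+ 2 ℓ₁ (2 * ℓ₂) ⟩
  2 * ℓ₁ + 2 * (2 * ℓ₂)
    ≡⟨ cong₂ (λ x y → x + 2 * y) (length-compositions (suc m) k 1≤k+1+m) (length-compositions m (suc k) (s≤s z≤n)) ⟩
  2 ^ suc m * b₁ + 2 * (2 ^ m * b₂)          ≡⟨ cong (2 ^ suc m * b₁ +_) (*-assoc 2 (2 ^ m) b₂) ⟨
  2 ^ suc m * b₁ + 2 ^ suc m * b₂            ≡⟨ *-distribˡ-+ (2 ^ suc m) b₁ b₂ ⟨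
  2 ^ suc m * (b₁ + b₂)                      ≡⟨ cong (2 ^ suc m *_) (binomials-pascal m k) ⟩
  2 ^ suc m * binomials (suc m) (suc k)      ∎
  where
  open ≡-Reasoning
  ℓ₁ = length (compositions (suc m) k)
  ℓ₂ = length (compositions m (suc k))
  b₁ = binomials (suc m) k
  b₂ = binomials m (suc k)
  1≤k+1+m = subst (1 ≤_) (sym (+-suc k m)) (s≤s z≤n)

perm∧isInvolution⇒Involution : ∀ {n π} → π ∈ perms n → T (isInvolution n π) → Involution n π
perm∧isInvolution⇒Involution {n} {π} π∈ inv = record { length≡ = length≡ ; involutive = involutive }
  where
  length≡ : length π ≡ n
  length≡ = length-∈-words n (range1 n) (proj₁ (∈-filter⁻ (T? ∘ isPerm n) π∈))
  involutive : ∀ {i} → i < n → at π (π ⟨ i ⟩) ≡ suc i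
  involutive i<n = ≡ᵇ⇒≡ _ _ (All.lookup (All.all⁺ _ (range1 n) inv) (∈-range1⁺ i<n))

Involution⇒perm∧isInvolution : ∀ {n π} → Involution n π → π ∈ perms n × T (isInvolution n π)
Involution⇒perm∧isInvolution {n} {π} π-inv = ∈-filter⁺ (T? ∘ isPerm n) π∈words isPerm-π , isInvolution-π
  where
  open Involution π-inv
  π∈words : π ∈ words n (range1 n)
  π∈words = subst (λ m → π ∈ words m (range1 n)) length≡ (∈-words⁺ (⟨⟩-All π entry∈range))
    where
    entry∈range : ∀ {i} → i < length π → π ⟨ i ⟩ ∈ range1 n
    entry∈range i< with v , πi≡ , v<n ← entry (subst (_ <_) length≡ i<) =
      subst (_∈ range1 n) (sym πi≡) (∈-range1⁺ v<n)
  isPerm-π : T (isPerm n π)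
  isPerm-π = All.all⁻ _ (tabulate occurs)
    where
    occurs : ∀ {v} → v ∈ range1 n → T (any (_≡ᵇ v) π)
    occurs v∈ with i , refl , i<n ← ∈-range1⁻ v∈ with w , πi≡ , w<n ← entry i<n =
      any⁺ _ (Any.map (λ { refl → ≡⇒≡ᵇ _ _ (inverse i<n πi≡) }) (⟨⟩-∈ π (subst (_ <_) (sym length≡) w<n)))
  isInvolution-π : T (isInvolution n π)
  isInvolution-π = All.all⁻ _ (tabulate fixes)
    where
    fixes : ∀ {v} → v ∈ range1 n → T (at π (at π v) ≡ᵇ v)
    fixes v∈ with i , refl , i<n ← ∈-range1⁻ v∈ = ≡⇒≡ᵇ _ _ (involutive i<n)

T-not : ∀ {b} → T (not b) ⇔ (¬ T b)
T-not {true}  = mk⇔ (λ ()) (λ ¬t → ¬t _)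
T-not {false} = mk⇔ (λ _ ()) (λ _ → _)

involutionsAvoiding : List ℕ → ℕ → ℕ → List (List ℕ)
involutionsAvoiding α n k =
  filterᵇ (λ π → isInvolution n π ∧ (fixedPoints n π ≡ᵇ k) ∧ not (contains α π)) (perms n)

∈-involutionsAvoiding⇔ : ∀ {α} → Is231or312 α → ∀ n k {π} →
  π ∈ involutionsAvoiding α n k ⇔ (Involution n π × Avoids231 π × fixedPoints n π ≡ k)
∈-involutionsAvoiding⇔ {α} hα n k {π} = mk⇔ to from
  where
  to : π ∈ involutionsAvoiding α n k → Involution n π × Avoids231 π × fixedPoints n π ≡ k
  to π∈ with π∈perms , holds ← ∈-filter⁻ (T? ∘ _) π∈ with isInv , rest ← Equivalence.to T-∧ holds
        with fixed , avoids ← Equivalence.to T-∧ rest =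
    π-inv , Equivalence.to T-not avoids ∘ Equivalence.from (contains⇔occurs231 hα π-inv) , ≡ᵇ⇒≡ _ _ fixed
    where π-inv = perm∧isInvolution⇒Involution π∈perms isInv
  from : Involution n π × Avoids231 π × fixedPoints n π ≡ k → π ∈ involutionsAvoiding α n k
  from (π-inv , avoids , fixed) with π∈perms , isInv ← Involution⇒perm∧isInvolution π-inv =
    ∈-filter⁺ (T? ∘ _) π∈perms (Equivalence.from T-∧ (isInv , Equivalence.from T-∧
      (≡⇒≡ᵇ _ _ fixed , Equivalence.from T-not (avoids ∘ Equivalence.to (contains⇔occurs231 hα π-inv)))))

Layered : ℕ → ℕ → List ℕ → Set
Layered n k π = ∃[ c ] size c ≡ n × oddParts c ≡ k × π ≡ layered c

∈-involutionsAvoiding⇔layered : ∀ {α} → Is231or312 α → ∀ n k {π} → π ∈ involutionsAvoiding α n k ⇔ Layered n k π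
∈-involutionsAvoiding⇔layered {α} hα n k {π} = ⇔.trans (∈-involutionsAvoiding⇔ hα n k) (mk⇔ to from)
  where
  to : Involution n π × Avoids231 π × fixedPoints n π ≡ k → Layered n k π
  to (π-inv , avoids , fixed) with c , size≡ , refl ← avoiding⇒layered π-inv avoids =
    c , size≡ , trans (sym (fixedPoints-layered c (Involution.length≡ π-inv))) fixed , refl
  from : Layered n k π → Involution n π × Avoids231 π × fixedPoints n π ≡ k
  from (c , refl , refl , refl) = π-inv , layered-avoids231 c , fixedPoints-layered c (Involution.length≡ π-inv)
    where π-inv = layered-involution c

involutionsAvoiding-unique : ∀ α n k → Unique (involutionsAvoiding α n k)
involutionsAvoiding-unique α n k = Unique.filter⁺ _ (Unique.filter⁺ _ (words-unique n (range1-unique n)))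

invCount-even : ∀ {α} → Is231or312 α → ∀ m k → invCount α (k + 2 * m) k ≡ length (compositions m k)
invCount-even {α} hα m k = begin
  length (involutionsAvoiding α (k + 2 * m) k)  ≡⟨ unique∧same-members⇒length≡ unique-lhs unique-rhs same ⟩
  length (map layered (compositions m k))       ≡⟨ length-map layered (compositions m k) ⟩
  length (compositions m k)                     ∎
  where
  open ≡-Reasoning
  unique-lhs = involutionsAvoiding-unique α (k + 2 * m) k
  unique-rhs = Unique.map⁺ layered-injective (compositions-unique m k)
  same : ∀ {π} → π ∈ involutionsAvoiding α (k + 2 * m) k ⇔ π ∈ map layered (compositions m k)
  same = ⇔.trans (∈-involutionsAvoiding⇔layered hα (k + 2 * m) k) (mk⇔ to from)
    where
    to : ∀ {π} → Layered (k + 2 * m) k π → π ∈ map layered (compositions m k)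
    to (c , size≡ , oddParts≡ , refl) = ∈-map⁺ layered (Equivalence.from (∈-compositions⇔ m k {c}) (size≡ , oddParts≡))
    from : ∀ {π} → π ∈ map layered (compositions m k) → Layered (k + 2 * m) k π
    from π∈ with c , c∈ , refl ← ∈-map⁻ layered π∈ with size≡ , oddParts≡ ← Equivalence.to (∈-compositions⇔ m k) c∈ =
      c , size≡ , oddParts≡ , refl

invCount-odd : ∀ {α} → Is231or312 α → ∀ n k → ¬ 2 ∣ n + k → invCount α n k ≡ 0
invCount-odd {α} hα n k odd = unique∧same-members⇒length≡ (involutionsAvoiding-unique α n k) [] (mk⇔ to λ ())
  where
  to : ∀ {π} → π ∈ involutionsAvoiding α n k → π ∈ []
  to π∈ with c , size≡ , oddParts≡ , _ ← Equivalence.to (∈-involutionsAvoiding⇔layered hα n k) π∈ =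
    contradiction (subst₂ (λ a b → 2 ∣ a + b) size≡ oddParts≡ (2∣size+oddParts c)) odd

even-gap : ∀ {n k} → k ≤ n → 2 ∣ n + k → ∃[ m ] n ≡ k + 2 * m
even-gap {n} {k} k≤n 2∣n+k =
  halve (∣m+n∣m⇒∣n (subst (2 ∣_) n+k≡ 2∣n+k) (divides k (solve 1 (λ x → x :+ x := x :* con 2) refl k)))
  where
  open +-*-Solver
  n+k≡ : n + k ≡ (k + k) + (n ∸ k)
  n+k≡ = trans (cong (_+ k) (sym (m+[n∸m]≡n k≤n))) (solve 2 (λ a d → (a :+ d) :+ a := (a :+ a) :+ d) refl k (n ∸ k))
  halve : 2 ∣ n ∸ k → ∃[ m ] n ≡ k + 2 * m
  halve (divides m d≡m*2) = m , trans (sym (m+[n∸m]≡n k≤n)) (cong (k +_) (trans d≡m*2 (*-comm m 2)))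

half-double : ∀ x → 2 * x / 2 ≡ x
half-double x = trans (cong (_/ 2) (*-comm 2 x)) (m*n/n≡m x 2)

halves : ∀ k m →
  (k + 2 * m ∸ k) / 2 ≡ m × (k + 2 * m + k) / 2 ≡ k + m × (k + 2 * m + k ∸ 2) / 2 ≡ k + m ∸ 1
halves k m =
  trans (cong (_/ 2) (m+n∸m≡n k (2 * m))) (half-double m) ,
  trans (cong (_/ 2) sum≡) (half-double (k + m)) ,
  trans (cong (λ x → (x ∸ 2) / 2) sum≡)
        (trans (cong (_/ 2) (sym (*-distribˡ-∸ 2 (k + m) 1))) (half-double (k + m ∸ 1)))
  where
  open +-*-Solver
  sum≡ : k + 2 * m + k ≡ 2 * (k + m)
  sum≡ = solve 2 (λ k m → k :+ con 2 :* m :+ k := con 2 :* (k :+ m)) refl k m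

theorem2p4 : (α : List ℕ) → (α ≡ 2 ∷ 3 ∷ 1 ∷ [] ⊎ α ≡ 3 ∷ 1 ∷ 2 ∷ []) →
    (n k : ℕ) → 1 ≤ n → k ≤ n →
      (2 ∣ n + k →
         2 * invCount α n k
           ≡ 2 ^ ((n ∸ k) / 2) * (((n + k) / 2) C ((n ∸ k) / 2) + ((n + k ∸ 2) / 2) C ((n ∸ k) / 2)))
      × (¬ (2 ∣ n + k) → invCount α n k ≡ 0)
theorem2p4 α hα n k 1≤n k≤n = even , invCount-odd hα n k
  where
  positive : ∀ k m → 1 ≤ k + 2 * m → 1 ≤ k + m
  positive (suc k) m       _ = s≤s z≤n
  positive zero    (suc m) _ = s≤s z≤n
  even : 2 ∣ n + k → 2 * invCount α n k
           ≡ 2 ^ ((n ∸ k) / 2) * (((n + k) / 2) C ((n ∸ k) / 2) + ((n + k ∸ 2) / 2) C ((n ∸ k) / 2))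
  even 2∣n+k with m , refl ← even-gap k≤n 2∣n+k with half-diff , half-sum , half-sum-2 ← halves k m
    rewrite half-diff | half-sum | half-sum-2 =
    trans (cong (2 *_) (invCount-even hα m k)) (length-compositions m k (positive k m 1≤n))
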